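{- Let $a,b$ be integers with $1\le a<b$ and $\gcd(a,b)=1$. Then there exist integers $k\ge 0$ and $n\ge 1$ with $$(b^2-a^2)^2=2^k\, n^b$$ if and only if either $(a,b)=(1,2)$ (for which $(b^2-a^2)^2=9=3^2$), or $(a,b)=(2^s-1,2^s+1)$ for some integer $s\ge 1$ (for which $(b^2-a^2)^2=2^{2s+4}\cdot 1^b$). -}

module Defs where

{-# OPTIONS --safe #-}
-- Write n = 2^e m with m odd. If m = 1, then (b² − a²)² = ((b − a)(b + a))² is a power of
-- two, hence so are b − a and b + a; coprimality makes a and b odd, which forces
-- b − a = 2, i.e. (a, b) = (2^s − 1, 2^s + 1). If m ≥ 3, then m^b divides
-- (b² − a²)² ≤ b⁴ < 3^b once b ≥ 8; the finitely many pairs with b ≤ 7 are checked by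
-- computation, and only (1, 2) survives.
module Submission where

open import Defs
open import Data.Nat using (ℕ; _+_; _*_; _∸_; _^_; _≤_; _<_)
open import Data.Nat.GCD using (gcd)
open import Data.Product using (_×_; ∃-syntax)
open import Data.Sum using (_⊎_)
open import Relation.Binary.PropositionalEquality using (_≡_)
open import Function.Bundles using (_⇔_)

open import Data.Nat using (zero; suc; z≤n; s≤s; NonZero; >-nonZero; _≟_; _≤?_; _<?_)
open import Data.Nat.Properties
open import Data.Nat.Divisibility
open import Data.Nat.Coprimality using (Coprime; coprime-divisor)
open import Data.Nat.GCD using (gcd-greatest)
open import Data.Nat.Induction using (<-rec)
open import Data.Nat.Tactic.RingSolver using (solve-∀)
open import Data.Product using (_,_; ∃₂; uncurry)
open import Data.Sum using (inj₁; inj₂; map₂)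
open import Relation.Nullary using (¬_; ¬?; Dec; yes; no; contradiction)
open import Relation.Nullary.Decidable using (from-yes; _×-dec_; _⊎-dec_; _→-dec_)
open import Relation.Binary.PropositionalEquality using (refl; sym; trans; cong; subst; module ≡-Reasoning)
open import Function.Bundles using (mk⇔)

Δ : ℕ → ℕ → ℕ
Δ a b = (b ^ 2 ∸ a ^ 2) ^ 2

Solvable : ℕ → ℕ → Set
Solvable a b = ∃[ k ] ∃[ n ] (1 ≤ n × Δ a b ≡ 2 ^ k * n ^ b)

FlanksPowerOfTwo : ℕ → ℕ → Set
FlanksPowerOfTwo a b = ∃[ s ] (1 ≤ s × a ≡ 2 ^ s ∸ 1 × b ≡ 2 ^ s + 1)

Exceptional : ℕ → ℕ → Set
Exceptional a b = (a ≡ 1 × b ≡ 2) ⊎ FlanksPowerOfTwo a b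

^-monoˡ-∣ : ∀ {m n} b → m ∣ n → m ^ b ∣ n ^ b
^-monoˡ-∣ zero    _   = ∣-refl
^-monoˡ-∣ (suc b) m∣n = *-pres-∣ m∣n (^-monoˡ-∣ b m∣n)

2∤1 : ¬ 2 ∣ 1
2∤1 2∣1 = contradiction (∣1⇒≡1 2∣1) λ ()

odd-part : ∀ n → 0 < n → ∃₂ λ e m → ¬ 2 ∣ m × n ≡ 2 ^ e * m
odd-part = <-rec _ halve
  where
  halve : ∀ n → (∀ {q} → q < n → 0 < q → ∃₂ λ e m → ¬ 2 ∣ m × q ≡ 2 ^ e * m) →
          0 < n → ∃₂ λ e m → ¬ 2 ∣ m × n ≡ 2 ^ e * m
  halve n rec 0<n with 2 ∣? n
  ... | no 2∤n = 0 , n , 2∤n , sym (*-identityˡ n)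
  ... | yes (divides q@(suc _) refl) with rec (m<m*n q 2 (s≤s (s≤s z≤n))) (s≤s z≤n)
  ...   | e , m , 2∤m , q≡2^e*m =
    suc e , m , 2∤m , trans (*-comm q 2) (trans (cong (2 *_) q≡2^e*m) (sym (*-assoc 2 (2 ^ e) m)))

odd⇒coprime-2 : ∀ {m} → ¬ 2 ∣ m → Coprime m 2
odd⇒coprime-2 _   {0}                 (_ , 0∣2) = contradiction (0∣⇒≡0 0∣2) λ ()
odd⇒coprime-2 _   {1}                 _         = refl
odd⇒coprime-2 2∤m {2}                 (2∣m , _) = contradiction 2∣m 2∤m
odd⇒coprime-2 _   {suc (suc (suc _))} (_ , d∣2) = contradiction (∣⇒≤ d∣2) λ { (s≤s (s≤s ())) }

odd∣2^k⇒≡1 : ∀ {m} k → ¬ 2 ∣ m → m ∣ 2 ^ k → m ≡ 1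
odd∣2^k⇒≡1 zero    _   m∣1     = ∣1⇒≡1 m∣1
odd∣2^k⇒≡1 (suc k) 2∤m m∣2^1+k = odd∣2^k⇒≡1 k 2∤m (coprime-divisor (odd⇒coprime-2 2∤m) m∣2^1+k)

∣2^k⇒≡2^ : ∀ {d} k → d ∣ 2 ^ k → ∃[ j ] d ≡ 2 ^ j
∣2^k⇒≡2^ {zero}  k 0∣2^k = contradiction (subst (0 <_) (0∣⇒≡0 0∣2^k) (m^n>0 2 k)) λ ()
∣2^k⇒≡2^ {suc d} k d∣2^k with odd-part (suc d) (s≤s z≤n)
... | e , m , 2∤m , d≡2^e*m =
  e , trans d≡2^e*m (trans (cong (2 ^ e *_) m≡1) (*-identityʳ (2 ^ e)))
  where
  m≡1 : m ≡ 1
  m≡1 = odd∣2^k⇒≡1 k 2∤m (∣-trans (subst (m ∣_) (sym d≡2^e*m) (n∣m*n (2 ^ e))) d∣2^k)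

[m+n]^2∸m^2≡n*[2m+n] : ∀ m n → (m + n) ^ 2 ∸ m ^ 2 ≡ n * (2 * m + n)
[m+n]^2∸m^2≡n*[2m+n] m n = trans (cong (_∸ m ^ 2) (expand m n)) (m+n∸m≡n (m ^ 2) _)
  where
  expand : ∀ m n → (m + n) * ((m + n) * 1) ≡ m * (m * 1) + n * (2 * m + n)
  expand = solve-∀

coprime-even-gap⇒odd : ∀ {a} c → gcd a (a + 2 * c) ≡ 1 → ¬ 2 ∣ a
coprime-even-gap⇒odd c gcd≡1 2∣a =
  2∤1 (subst (2 ∣_) gcd≡1 (gcd-greatest 2∣a (∣m∣n⇒∣m+n 2∣a (m∣m*n c))))

odd+2^u≡2^v⇒flanks : ∀ {a} u v → ¬ 2 ∣ a → a + 2 ^ u ≡ 2 ^ v → FlanksPowerOfTwo a (a + 2 * 2 ^ u)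
odd+2^u≡2^v⇒flanks {a} zero zero 2∤a a+1≡1 =
  contradiction (subst (2 ∣_) (sym (+-cancelʳ-≡ 1 a 0 a+1≡1)) (2 ∣0)) 2∤a
odd+2^u≡2^v⇒flanks {a} zero (suc v) _ a+1≡2^[1+v] =
  suc v , s≤s z≤n ,
  trans (sym (m+n∸n≡m a 1)) (cong (_∸ 1) a+1≡2^[1+v]) ,
  trans (sym (+-assoc a 1 1)) (cong (_+ 1) a+1≡2^[1+v])
odd+2^u≡2^v⇒flanks {a} (suc u) zero _ a+2^[1+u]≡1 =
  contradiction (subst (2 ≤_) a+2^[1+u]≡1 (≤-trans (*-monoʳ-≤ 2 (m^n>0 2 u)) (m≤n+m _ a))) λ { (s≤s ()) }
odd+2^u≡2^v⇒flanks {a} (suc u) (suc v) 2∤a a+2^[1+u]≡2^[1+v] = contradiction 2∣a 2∤a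
  where
  2∣a : 2 ∣ a
  2∣a = ∣m+n∣m⇒∣n (subst (2 ∣_) (trans (sym a+2^[1+u]≡2^[1+v]) (+-comm a _)) (m∣m*n (2 ^ v)))
                   (m∣m*n (2 ^ u))

gap∧sum≡2^⇒flanks : ∀ {a d} u v → 1 ≤ a → gcd a (a + d) ≡ 1 →
                   d ≡ 2 ^ u → 2 * a + d ≡ 2 ^ v → FlanksPowerOfTwo a (a + d)
gap∧sum≡2^⇒flanks {a} zero zero 1≤a _ refl 2a+1≡1 =
  contradiction (subst (2 ≤_) 2a+1≡1 (≤-trans (*-monoʳ-≤ 2 1≤a) (m≤m+n (2 * a) 1))) λ { (s≤s ()) }
gap∧sum≡2^⇒flanks {a} zero (suc v) _ _ refl 2a+1≡2^[1+v] =
  contradiction (trans (sym 2a+1≡2^[1+v]) (+-comm (2 * a) 1)) (even≢odd (2 ^ v) a)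
gap∧sum≡2^⇒flanks {a} (suc u) zero _ _ refl 2a+2^[1+u]≡1 =
  contradiction (trans (*-distribˡ-+ 2 a (2 ^ u)) 2a+2^[1+u]≡1) (even≢odd (a + 2 ^ u) 0)
gap∧sum≡2^⇒flanks {a} (suc u) (suc v) _ gcd≡1 refl 2a+2^[1+u]≡2^[1+v] =
  odd+2^u≡2^v⇒flanks u v (coprime-even-gap⇒odd (2 ^ u) gcd≡1)
    (*-cancelˡ-≡ _ _ 2 (trans (*-distribˡ-+ 2 a (2 ^ u)) 2a+2^[1+u]≡2^[1+v]))

Δ≡2^⇒flanks : ∀ {a b} K → 1 ≤ a → a < b → gcd a b ≡ 1 → Δ a b ≡ 2 ^ K → FlanksPowerOfTwo a b
Δ≡2^⇒flanks {a} K 1≤a a<b gcd≡1 Δ≡2^K with m≤n⇒∃[o]m+o≡n (<⇒≤ a<b)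
... | d , refl with ∣2^k⇒≡2^ K (factor-∣ (m∣m*n (2 * a + d))) | ∣2^k⇒≡2^ K (factor-∣ (n∣m*n d))
  where
  factor-∣ : ∀ {x} → x ∣ d * (2 * a + d) → x ∣ 2 ^ K
  factor-∣ x∣ = subst (_ ∣_) (trans (cong (_^ 2) (sym ([m+n]^2∸m^2≡n*[2m+n] a d))) Δ≡2^K) (∣m⇒∣m*n _ x∣)
...   | u , d≡2^u | v , 2a+d≡2^v = gap∧sum≡2^⇒flanks u v 1≤a gcd≡1 d≡2^u 2a+d≡2^v

OddPowerFree : ℕ → ℕ → Set
OddPowerFree b W = ∀ {m} → 3 ≤ m → ¬ 2 ∣ m → ¬ m ^ b ∣ W

<3^⇒oddPowerFree : ∀ b {W} .{{_ : NonZero W}} → W < 3 ^ b → OddPowerFree b W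
<3^⇒oddPowerFree b W<3^b 3≤m _ m^b∣W = <⇒≱ W<3^b (≤-trans (^-monoˡ-≤ b 3≤m) (∣⇒≤ m^b∣W))

3^∤∧<5^⇒oddPowerFree : ∀ b {W} .{{_ : NonZero W}} → ¬ 3 ^ b ∣ W → W < 5 ^ b → OddPowerFree b W
3^∤∧<5^⇒oddPowerFree _ _ _ {1} (s≤s ())
3^∤∧<5^⇒oddPowerFree _ _ _ {2} (s≤s (s≤s ()))
3^∤∧<5^⇒oddPowerFree _ 3^b∤W _ {3} _ _ 3^b∣W = 3^b∤W 3^b∣W
3^∤∧<5^⇒oddPowerFree _ _ _ {4} _ 2∤4 _ = 2∤4 (divides 2 refl)
3^∤∧<5^⇒oddPowerFree b _ W<5^b {suc (suc (suc (suc (suc m))))} _ _ m^b∣W =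
  <⇒≱ W<5^b (≤-trans (^-monoˡ-≤ b (m≤m+n 5 m)) (∣⇒≤ m^b∣W))

[m*n]^4≡m^4*n^4 : ∀ m n → (m * n) ^ 4 ≡ m ^ 4 * n ^ 4
[m*n]^4≡m^4*n^4 = expanded
  where
  expanded : ∀ m n → (m * n) * ((m * n) * ((m * n) * ((m * n) * 1))) ≡
                     m * (m * (m * (m * 1))) * (n * (n * (n * (n * 1))))
  expanded = solve-∀

[1+b]^4≤3*b^4 : ∀ b → 8 ≤ b → (1 + b) ^ 4 ≤ 3 * b ^ 4
[1+b]^4≤3*b^4 b 8≤b = *-cancelˡ-≤ (8 ^ 4) (begin
  8 ^ 4 * (1 + b) ^ 4    ≡⟨ [m*n]^4≡m^4*n^4 8 (1 + b) ⟨
  (8 * (1 + b)) ^ 4      ≤⟨ ^-monoˡ-≤ 4 8[1+b]≤9b ⟩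
  (9 * b) ^ 4            ≡⟨ [m*n]^4≡m^4*n^4 9 b ⟩
  9 ^ 4 * b ^ 4          ≤⟨ *-monoˡ-≤ (b ^ 4) (from-yes (9 ^ 4 ≤? 8 ^ 4 * 3)) ⟩
  8 ^ 4 * 3 * b ^ 4      ≡⟨ *-assoc (8 ^ 4) 3 (b ^ 4) ⟩
  8 ^ 4 * (3 * b ^ 4)    ∎)
  where
  open ≤-Reasoning
  8[1+b]≤9b : 8 * (1 + b) ≤ 9 * b
  8[1+b]≤9b = subst (_≤ 9 * b) (sym (*-distribˡ-+ 8 1 b)) (+-monoˡ-≤ (8 * b) 8≤b)

b^4<3^b : ∀ b → 8 ≤ b → b ^ 4 < 3 ^ b
b^4<3^b b 8≤b = subst (λ c → c ^ 4 < 3 ^ c) (m+[n∸m]≡n 8≤b) (shifted (b ∸ 8))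
  where
  shifted : ∀ c → (8 + c) ^ 4 < 3 ^ (8 + c)
  shifted zero    = from-yes (8 ^ 4 <? 3 ^ 8)
  shifted (suc c) = ≤-<-trans ([1+b]^4≤3*b^4 (8 + c) (m≤m+n 8 c)) (*-monoʳ-< 3 (shifted c))

Δ-nonZero : ∀ {a b} → a < b → NonZero (Δ a b)
Δ-nonZero {a} {b} a<b = m^n≢0 (b ^ 2 ∸ a ^ 2) 2 {{>-nonZero (m<n⇒0<n∸m (^-monoˡ-< 2 a<b))}}

Δ≤b^4 : ∀ a b → Δ a b ≤ b ^ 4
Δ≤b^4 a b = subst (Δ a b ≤_) (^-*-assoc b 2 2) (^-monoˡ-≤ 2 (m∸n≤m (b ^ 2) (a ^ 2)))

-- Without the gcd hypothesis the pair (3, 6) would fail too: Δ 3 6 = 3 ^ 6.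
small-cases : ∀ {b} → b < 8 → ∀ {a} → a < b → gcd a b ≡ 1 →
              (a ≡ 1 × b ≡ 2) ⊎ (¬ 3 ^ b ∣ Δ a b × Δ a b < 5 ^ b)
small-cases = from-yes (allUpTo? (λ b → allUpTo? (λ a → gcd a b ≟ 1 →-dec certified? a b) b) 8)
  where
  certified? : ∀ a b → Dec ((a ≡ 1 × b ≡ 2) ⊎ (¬ 3 ^ b ∣ Δ a b × Δ a b < 5 ^ b))
  certified? a b = (a ≟ 1 ×-dec b ≟ 2) ⊎-dec (¬? (3 ^ b ∣? Δ a b) ×-dec Δ a b <? 5 ^ b)

Δ-oddPowerFree : ∀ {a b} → a < b → gcd a b ≡ 1 → (a ≡ 1 × b ≡ 2) ⊎ OddPowerFree b (Δ a b)
Δ-oddPowerFree {a} {b} a<b gcd≡1 with ≤-<-connex b 7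
... | inj₁ b≤7 =
  map₂ (uncurry (3^∤∧<5^⇒oddPowerFree b {{Δ-nonZero a<b}})) (small-cases (s≤s b≤7) a<b gcd≡1)
... | inj₂ 7<b =
  inj₂ (<3^⇒oddPowerFree b {{Δ-nonZero a<b}} (≤-<-trans (Δ≤b^4 a b) (b^4<3^b b 7<b)))

m^k*[m^e]^b≡m^[k+e*b] : ∀ m k e b → m ^ k * (m ^ e) ^ b ≡ m ^ (k + e * b)
m^k*[m^e]^b≡m^[k+e*b] m k e b =
  trans (cong (m ^ k *_) (^-*-assoc m e b)) (sym (^-distribˡ-+-* m k (e * b)))

solvable⇒exceptional : ∀ {a b} → 1 ≤ a → a < b → gcd a b ≡ 1 → Solvable a b → Exceptional a b
solvable⇒exceptional {a} {b} 1≤a a<b gcd≡1 (k , n , 1≤n , Δ≡2^k*n^b) with odd-part n 1≤n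
... | _ , 0 , 2∤0 , _ = contradiction (2 ∣0) 2∤0
... | e , 1 , _ , refl = inj₂ (Δ≡2^⇒flanks (k + e * b) 1≤a a<b gcd≡1 (begin
  Δ a b                   ≡⟨ Δ≡2^k*n^b ⟩
  2 ^ k * (2 ^ e * 1) ^ b ≡⟨ cong (λ x → 2 ^ k * x ^ b) (*-identityʳ (2 ^ e)) ⟩
  2 ^ k * (2 ^ e) ^ b     ≡⟨ m^k*[m^e]^b≡m^[k+e*b] 2 k e b ⟩
  2 ^ (k + e * b)         ∎))
  where open ≡-Reasoning
... | _ , 2 , 2∤2 , _ = contradiction ∣-refl 2∤2
... | e , m@(suc (suc (suc _))) , 2∤m , refl =
  map₂ (λ free → contradiction m^b∣Δ (free (s≤s (s≤s (s≤s z≤n))) 2∤m)) (Δ-oddPowerFree a<b gcd≡1)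
  where
  m^b∣Δ : m ^ b ∣ Δ a b
  m^b∣Δ = subst (m ^ b ∣_) (sym Δ≡2^k*n^b) (∣n⇒∣m*n (2 ^ k) (^-monoˡ-∣ b (n∣m*n (2 ^ e))))

flank-Δ : ∀ q → Δ q (q + 2) ≡ (4 * (q + 1)) ^ 2
flank-Δ q = cong (_^ 2) (trans ([m+n]^2∸m^2≡n*[2m+n] q 2) (regroup q))
  where
  regroup : ∀ q → 2 * (2 * q + 2) ≡ 4 * (q + 1)
  regroup = solve-∀

flank-solution : ∀ s → Δ (2 ^ s ∸ 1) (2 ^ s + 1) ≡ 2 ^ ((2 + s) * 2) * 1 ^ (2 ^ s + 1)
flank-solution s = begin
  Δ q (2 ^ s + 1)                      ≡⟨ cong (Δ q) (trans (cong (_+ 1) (sym q+1≡2^s)) (+-assoc q 1 1)) ⟩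
  Δ q (q + 2)                          ≡⟨ flank-Δ q ⟩
  (4 * (q + 1)) ^ 2                    ≡⟨ cong (λ x → (4 * x) ^ 2) q+1≡2^s ⟩
  (2 ^ 2 * 2 ^ s) ^ 2                  ≡⟨ cong (_^ 2) (^-distribˡ-+-* 2 2 s) ⟨
  (2 ^ (2 + s)) ^ 2                    ≡⟨ ^-*-assoc 2 (2 + s) 2 ⟩
  2 ^ ((2 + s) * 2)                    ≡⟨ *-identityʳ _ ⟨
  2 ^ ((2 + s) * 2) * 1                ≡⟨ cong (2 ^ ((2 + s) * 2) *_) (^-zeroˡ (2 ^ s + 1)) ⟨
  2 ^ ((2 + s) * 2) * 1 ^ (2 ^ s + 1)  ∎
  where
  open ≡-Reasoning
  q : ℕ
  q = 2 ^ s ∸ 1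
  q+1≡2^s : q + 1 ≡ 2 ^ s
  q+1≡2^s = m∸n+n≡m (m^n>0 2 s)

exceptional⇒solvable : ∀ {a b} → Exceptional a b → Solvable a b
exceptional⇒solvable (inj₁ (refl , refl))       = 0 , 3 , s≤s z≤n , refl
exceptional⇒solvable (inj₂ (s , _ , refl , refl)) = (2 + s) * 2 , 1 , s≤s z≤n , flank-solution s

proposition10 : (a b : ℕ) → 1 ≤ a → a < b → gcd a b ≡ 1 →
    ((∃[ k ] ∃[ n ] (1 ≤ n × ((b ^ 2 ∸ a ^ 2) ^ 2 ≡ 2 ^ k * n ^ b)))
      ⇔ ((a ≡ 1 × b ≡ 2) ⊎ (∃[ s ] (1 ≤ s × a ≡ 2 ^ s ∸ 1 × b ≡ 2 ^ s + 1))))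
proposition10 a b 1≤a a<b gcd≡1 = mk⇔ (solvable⇒exceptional 1≤a a<b gcd≡1) exceptional⇒solvable
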